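{- (i) For a spraid $(\mathcal V,\mathcal T_\#)$ derived from $(V,\#,\preccurlyeq)$, the collection $\mathcal T_{\mathrm{ind}}$ of inductively open subsets of $\mathcal V$ is a topology, and the apartness topology refines it. (ii) Let $(\mathcal V,\mathcal T_\#)$ be an inductive spraid derived from $(V,\#,\preccurlyeq)$. Then for finite subsets $A,B\subseteq V$ with $a\#b$ for all $a\in A,b\in B$, the set $C=\{c\in V: c\#a\text{ for all }a\in A,\text{ or } c\#b\text{ for all }b\in B\}$ is an inductive bar on $V$.
   Context: Setting: Bishop-style constructive mathematics with induction over genetic bars. Pre-natural space $(V,\#,\preccurlyeq)$: $V$ countable, $\#,\preccurlyeq$ decidable, $\#$ symmetric irreflexive, $\preccurlyeq$ partial order, $a\preccurlyeq b\wedge c\#b\Rightarrow c\#a$; $a\prec b$ means $a\preccurlyeq b,a\ne b$; maximal dot $\top$. Points: sequences $(x_n)$ with $x_{n+1}\preccurlyeq x_n$, for each $n$ some $m$ with $x_m\prec x_n$, for each $c\#d$ some $m$ with $x_m\#c$ or $x_m\#d$; $x\#y$ iff $\exists n\,x_n\#y_n$; $\hat b=\{y:\exists m\,y_m\prec b\}$; apartness topology: $U$ open iff for all $x\in U$, $y$ a point, one can determine $y\#x$ or $\widehat{y_m}\subseteq U$ for some $m$. Spraid: natural space (every dot contains a point) whose dots form a trea (finitely many dots above each $a$, all chains of immediate successors from $\top$ to $a$ of common length $\mathrm{grd}(a)$) and in which every infinite strictly decreasing sequence of dots is a point. Genetic bars on $V_a=\{b:b\preccurlyeq a\}$: $\{a\}$,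 and $\bigcup_{b\in\mathrm{suc}(a)}B_b$ for genetic bars $B_b$ on $V_b$ ($\mathrm{suc}(a)$ = immediate successors of $a$). An inductive bar on $V$ is a set $B$ such that for some genetic bar $G$ on $V$ every $g\in G$ satisfies $g\preccurlyeq b$ for some $b\in B$. An apartness-open $U\subseteq\mathcal V$ is inductively open if for every $x\in U$ the set $\{b\in V: b\# x_{\mathrm{grd}(b)}\text{ or }\hat b\subseteq U\}$ is an inductive bar on $V$. An inductive spraid is a spraid such that (a) for all $a\#b$ the set $\{c:c\#a\text{ or }c\#b\}$ is an inductive bar on $V$, and (b) every apartness-open set is inductively open. -}

module Defs where

open import Level using (0ℓ)
open import Data.Nat using (ℕ; zero; suc)
open import Data.Product using (Σ; ∃; ∃-syntax; _×_; _,_)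
open import Data.Sum using (_⊎_)
open import Data.Empty using (⊥)
open import Data.Unit renaming (⊤ to Unit)
open import Data.List using (List)
open import Data.List.Membership.Propositional using (_∈_)
open import Relation.Nullary using (¬_)
open import Relation.Binary using (Decidable)
open import Relation.Binary.PropositionalEquality using (_≡_; _≢_)
open import Relation.Unary using (Pred; _⊆_)

record PreNaturalSpace : Set₁ where
  field
    V        : Set
    enum     : ℕ → V
    enum-sur : ∀ a → ∃[ n ] enum n ≡ a
    _#_      : V → V → Set
    _≼_      : V → V → Set
    #-dec    : Decidable _#_
    ≼-dec    : Decidable _≼_
    #-sym    : ∀ {a b} → a # b → b # a
    #-irr    : ∀ {a} → ¬ (a # a)
    ≼-refl   : ∀ {a} → a ≼ a
    ≼-trans  : ∀ {a b c} → a ≼ b → b ≼ c → a ≼ c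
    ≼-antisym : ∀ {a b} → a ≼ b → b ≼ a → a ≡ b
    #-mono   : ∀ {a b c} → a ≼ b → c # b → c # a
    ⊤        : V
    ≼-⊤      : ∀ a → a ≼ ⊤

  infix 4 _≺_
  _≺_ : V → V → Set
  a ≺ b = (a ≼ b) × (a ≢ b)

  -- b is an immediate successor of a (b lies directly below a)
  IsSuc : V → V → Set
  IsSuc b a = (b ≺ a) × (∀ c → b ≺ c → ¬ (c ≺ a))

  record IsPoint (x : ℕ → V) : Set where
    field
      decr   : ∀ n → x (suc n) ≼ x n
      shrink : ∀ n → ∃[ m ] x m ≺ x n
      sep    : ∀ c d → c # d → ∃[ m ] ((x m # c) ⊎ (x m # d))

  Point : Set
  Point = Σ (ℕ → V) IsPoint

  pt : Point → ℕ → V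
  pt (x , _) = x

  _#ₚ_ : Point → Point → Set
  x #ₚ y = ∃[ n ] (pt x n # pt y n)

  hat : V → Pred Point 0ℓ
  hat b y = ∃[ m ] (pt y m ≺ b)

  ApartOpen : Pred Point 0ℓ → Set
  ApartOpen U = ∀ x → U x → ∀ (y : Point) →
                  (y #ₚ x) ⊎ (∃[ m ] (hat (pt y m) ⊆ U))

  data Chain : V → ℕ → Set where
    start : Chain ⊤ zero
    step  : ∀ {a b n} → Chain a n → IsSuc b a → Chain b (suc n)

  data GBar (a : V) : Set where
    leaf : GBar a
    node : ((b : V) → IsSuc b a → GBar b) → GBar a

  _∈G_ : ∀ {a} → V → GBar a → Set
  _∈G_ {a} g leaf     = g ≡ a
  _∈G_ {a} g (node f) = ∃[ b ] Σ (IsSuc b a) (λ p → g ∈G f b p)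

  InductiveBar : Pred V 0ℓ → Set
  InductiveBar B = Σ (GBar ⊤) (λ G → ∀ g → g ∈G G → ∃[ b ] (B b × (g ≼ b)))

record Spraid : Set₁ where
  field
    pns : PreNaturalSpace
  open PreNaturalSpace pns
  field
    natural      : ∀ a → ∃[ x ] hat a x
    finite-above : ∀ a → Σ (List V) (λ L → ∀ b → (a ≼ b → b ∈ L) × (b ∈ L → a ≼ b))
    grd          : V → ℕ
    chain-exists : ∀ a → Chain a (grd a)
    chain-length : ∀ a n → Chain a n → n ≡ grd a
    decr-point   : ∀ (s : ℕ → V) → (∀ n → s (suc n) ≺ s n) → IsPoint s

  InductivelyOpen : Pred Point 0ℓ → Set
  InductivelyOpen U = ApartOpen U ×
    (∀ x → U x → InductiveBar (λ b → (b # pt x (grd b)) ⊎ (hat b ⊆ U)))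

  record IsInductive : Set₁ where
    field
      ind-apart : ∀ a b → a # b → InductiveBar (λ c → (c # a) ⊎ (c # b))
      ind-open  : ∀ (U : Pred Point 0ℓ) → ApartOpen U → InductivelyOpen U

record IsTopology {X : Set} (𝒯 : Pred (Pred X 0ℓ) 0ℓ) : Set₁ where
  field
    empty-open : 𝒯 (λ _ → ⊥)
    full-open  : 𝒯 (λ _ → Unit)
    inter-open : ∀ U W → 𝒯 U → 𝒯 W → 𝒯 (λ x → U x × W x)
    union-open : ∀ (I : Set) (U : I → Pred X 0ℓ) → (∀ i → 𝒯 (U i)) →
                 𝒯 (λ x → ∃[ i ] U i x)

-- Two genetic bars have a common refinement, obtained by descending both trees in
-- parallel, so inductive bars are closed under intersection up to passing to smaller
-- dots. This gives closure of the inductively open sets under binary intersection; the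
-- other topology axioms, and apartness-openness, are immediate. For (ii), refining the
-- bars of condition (a) for all pairs in A × B yields a bar of dots c with c # a or
-- c # b for every such pair, and as # is decidable each such c is apart from all of A
-- or from all of B.
module Submission where

open import Defs
open import Level using (0ℓ)
open import Function using (id)
open import Data.Nat using (_≤_; _≤′_; _⊔_; ≤′-refl; ≤′-step)
open import Data.Nat.Properties using (≤⇒≤′; m≤m⊔n; m≤n⊔m)
open import Data.Product using (_×_; ∃-syntax; _,_; proj₁; proj₂; uncurry)
open import Data.Sum using (_⊎_; inj₁; inj₂; [_,_])
open import Data.Empty using (⊥)
open import Data.Unit using () renaming (⊤ to Unit)
open import Data.List using (List; []; _∷_; cartesianProduct)
open import Data.List.Membership.Propositional using (_∈_; find)
open import Data.List.Membership.Propositional.Properties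
  using (∈-cartesianProduct⁺; ∈-cartesianProduct⁻)
open import Data.List.Relation.Unary.Any using (here; there)
open import Data.List.Relation.Unary.All as All using (all?)
open import Data.List.Relation.Unary.All.Properties using (¬All⇒Any¬)
open import Relation.Nullary using (yes; no; contradiction)
open import Relation.Unary using (Pred; Decidable; _⊆_; _∩_; _∪_)
open import Relation.Binary.PropositionalEquality using (refl)

∀∈×∀∈-⊎ : ∀ {X Y : Set} {P : Pred X 0ℓ} {Q : Pred Y 0ℓ} → Decidable P →
  ∀ xs ys → (∀ x y → x ∈ xs → y ∈ ys → P x ⊎ Q y) →
  (∀ x → x ∈ xs → P x) ⊎ (∀ y → y ∈ ys → Q y)
∀∈×∀∈-⊎ P? xs ys P⊎Q with all? P? xs
... | yes all = inj₁ λ _ x∈xs → All.lookup all x∈xs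
... | no ¬all with find (¬All⇒Any¬ P? xs ¬all)
...   | x , x∈xs , ¬Px =
  inj₂ λ y y∈ys → [ (λ Px → contradiction Px ¬Px) , id ] (P⊎Q x y x∈xs y∈ys)

module PreNaturalSpaceProperties (P : PreNaturalSpace) where
  open PreNaturalSpace P

  ≺-≼-trans : ∀ {a b c} → a ≺ b → b ≼ c → a ≺ c
  ≺-≼-trans (a≼b , a≢b) b≼c =
    ≼-trans a≼b b≼c , λ { refl → a≢b (≼-antisym a≼b b≼c) }

  hat-mono : ∀ {a b} → a ≼ b → hat a ⊆ hat b
  hat-mono a≼b (m , yₘ≺a) = m , ≺-≼-trans yₘ≺a a≼b

  pt-antitone : ∀ (x : Point) {m k} → m ≤′ k → pt x k ≼ pt x m
  pt-antitone x ≤′-refl        = ≼-refl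
  pt-antitone x (≤′-step m≤′k) = ≼-trans (IsPoint.decr (proj₂ x) _) (pt-antitone x m≤′k)

  apartOpen-∩ : ∀ {U W} → ApartOpen U → ApartOpen W → ApartOpen (U ∩ W)
  apartOpen-∩ U-open W-open x (Ux , Wx) y with U-open x Ux y | W-open x Wx y
  ... | inj₁ y#x | _       = inj₁ y#x
  ... | inj₂ _   | inj₁ y#x = inj₁ y#x
  ... | inj₂ (m , ŷₘ⊆U) | inj₂ (n , ŷₙ⊆W) =
    inj₂ (m ⊔ n , λ {z} z∈ → ŷₘ⊆U (shrink (m≤m⊔n m n) {z} z∈) , ŷₙ⊆W (shrink (m≤n⊔m m n) {z} z∈))
    where
    shrink : ∀ {i} → i ≤ m ⊔ n → hat (pt y (m ⊔ n)) ⊆ hat (pt y i)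
    shrink i≤m⊔n {z} = hat-mono (pt-antitone y (≤⇒≤′ i≤m⊔n)) {z}

  apartOpen-⋃ : ∀ (I : Set) (U : I → Pred Point 0ℓ) → (∀ i → ApartOpen (U i)) →
    ApartOpen (λ x → ∃[ i ] U i x)
  apartOpen-⋃ I U U-open x (i , Uᵢx) y with U-open i x Uᵢx y
  ... | inj₁ y#x         = inj₁ y#x
  ... | inj₂ (m , ŷₘ⊆Uᵢ) = inj₂ (m , λ z∈ → i , ŷₘ⊆Uᵢ z∈)

  ∈G-≼ : ∀ {a} (G : GBar a) {g} → g ∈G G → g ≼ a
  ∈G-≼ leaf     refl              = ≼-refl
  ∈G-≼ (node f) (b , b-suc , g∈G) = ≼-trans (∈G-≼ (f b b-suc) g∈G) (proj₁ (proj₁ b-suc))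

  _∧G_ : ∀ {a} → GBar a → GBar a → GBar a
  leaf   ∧G G      = G
  node f ∧G leaf   = node f
  node f ∧G node h = node λ b b-suc → f b b-suc ∧G h b b-suc

  Below : Pred V 0ℓ → Pred V 0ℓ
  Below B g = ∃[ b ] (B b × (g ≼ b))

  ∈G-∧G : ∀ {a} (G H : GBar a) {g} → g ∈G (G ∧G H) →
    Below (_∈G G) g × Below (_∈G H) g
  ∈G-∧G {a} leaf H g∈H = (a , refl , ∈G-≼ H g∈H) , (_ , g∈H , ≼-refl)
  ∈G-∧G {a} (node f) leaf g∈G = (_ , g∈G , ≼-refl) , (a , refl , ∈G-≼ (node f) g∈G)
  ∈G-∧G (node f) (node h) (b , b-suc , g∈) with ∈G-∧G (f b b-suc) (h b b-suc) g∈
  ... | (g₁ , g₁∈ , g≼g₁) , (g₂ , g₂∈ , g≼g₂) =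
    (g₁ , (b , b-suc , g₁∈) , g≼g₁) , (g₂ , (b , b-suc , g₂∈) , g≼g₂)

  below-trans : ∀ {B} → Below (Below B) ⊆ Below B
  below-trans (c , (b , Bb , c≼b) , g≼c) = b , Bb , ≼-trans g≼c c≼b

  DownClosed : Pred V 0ℓ → Set
  DownClosed Q = ∀ {g h} → g ≼ h → Q h → Q g

  below-downClosed : ∀ {Q} → DownClosed Q → Below Q ⊆ Q
  below-downClosed Q↓ (h , Qh , g≼h) = Q↓ g≼h Qh

  below-mono : ∀ {B C} → B ⊆ C → Below B ⊆ Below C
  below-mono B⊆C (b , Bb , g≼b) = b , B⊆C Bb , g≼b

  below-∈G : ∀ {a} {G : GBar a} {B} → (∀ g → g ∈G G → Below B g) → Below (_∈G G) ⊆ Below B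
  below-∈G G↓B (h , h∈G , g≼h) = below-trans (h , G↓B h h∈G , g≼h)

  #-downClosed : ∀ a → DownClosed (_# a)
  #-downClosed a g≼h h#a = #-sym (#-mono g≼h (#-sym h#a))

  downClosed-∪ : ∀ {Q R} → DownClosed Q → DownClosed R → DownClosed (Q ∪ R)
  downClosed-∪ Q↓ R↓ g≼h (inj₁ Qh) = inj₁ (Q↓ g≼h Qh)
  downClosed-∪ Q↓ R↓ g≼h (inj₂ Rh) = inj₂ (R↓ g≼h Rh)

  inductiveBar-⊤ : ∀ {B} → B ⊤ → InductiveBar B
  inductiveBar-⊤ B⊤ = leaf , λ { _ refl → ⊤ , B⊤ , ≼-refl }

  inductiveBar-mono : ∀ {B C} → B ⊆ C → InductiveBar B → InductiveBar C
  inductiveBar-mono B⊆C (G , G↓B) = G , λ g g∈G → below-mono B⊆C (G↓B g g∈G)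

  inductiveBar-below : ∀ {B} → InductiveBar (Below B) → InductiveBar B
  inductiveBar-below (G , G↓↓B) = G , λ g g∈G → below-trans (G↓↓B g g∈G)

  inductiveBar-∩ : ∀ {B C} → InductiveBar B → InductiveBar C → InductiveBar (Below B ∩ Below C)
  inductiveBar-∩ (G , G↓B) (H , H↓C) = G ∧G H , λ g g∈ →
    let (g↓G , g↓H) = ∈G-∧G G H g∈ in
    g , (below-∈G G↓B g↓G , below-∈G H↓C g↓H) , ≼-refl

  inductiveBar-∩-downClosed : ∀ {Q R} → DownClosed Q → DownClosed R →
    InductiveBar Q → InductiveBar R → InductiveBar (Q ∩ R)
  inductiveBar-∩-downClosed Q↓ R↓ Q-bar R-bar =
    inductiveBar-mono (λ (g↓Q , g↓R) → below-downClosed Q↓ g↓Q , below-downClosed R↓ g↓R)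
                      (inductiveBar-∩ Q-bar R-bar)

  inductiveBar-⋂ : ∀ {X : Set} {Q : X → Pred V 0ℓ} → (∀ x → DownClosed (Q x)) →
    ∀ xs → (∀ x → x ∈ xs → InductiveBar (Q x)) →
    InductiveBar (λ g → ∀ x → x ∈ xs → Q x g)
  inductiveBar-⋂ Q↓ []       _    = inductiveBar-⊤ λ _ ()
  inductiveBar-⋂ {Q = Q} Q↓ (x ∷ xs) bars =
    inductiveBar-mono cons
      (inductiveBar-∩-downClosed (Q↓ x) (λ g≼h Qh y y∈ → Q↓ y g≼h (Qh y y∈))
        (bars x (here refl)) (inductiveBar-⋂ Q↓ xs (λ y y∈ → bars y (there y∈))))
    where
    cons : Q x ∩ (λ g → ∀ y → y ∈ xs → Q y g) ⊆ (λ g → ∀ y → y ∈ x ∷ xs → Q y g)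
    cons (Qx , Qxs) _ (here refl) = Qx
    cons (Qx , Qxs) y (there y∈)  = Qxs y y∈

module SpraidProperties (S : Spraid) where
  open Spraid S
  open PreNaturalSpace pns
  open PreNaturalSpaceProperties pns

  ApartOrInside : Pred Point 0ℓ → Point → Pred V 0ℓ
  ApartOrInside U x b = (b # pt x (grd b)) ⊎ (hat b ⊆ U)

  apartOrInside-mono : ∀ {U W} x → U ⊆ W → ApartOrInside U x ⊆ ApartOrInside W x
  apartOrInside-mono x U⊆W (inj₁ b#x) = inj₁ b#x
  apartOrInside-mono x U⊆W (inj₂ b̂⊆U) = inj₂ λ z∈ → U⊆W (b̂⊆U z∈)

  -- Unless one side is witnessed by a dot apart from x, the dot g itself witnesses U ∩ W.
  below-apartOrInside-∩ : ∀ {U W} x →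
    Below (ApartOrInside U x) ∩ Below (ApartOrInside W x) ⊆ Below (ApartOrInside (U ∩ W) x)
  below-apartOrInside-∩ x ((b , inj₁ b#x , g≼b) , _) = b , inj₁ b#x , g≼b
  below-apartOrInside-∩ x (_ , (c , inj₁ c#x , g≼c)) = c , inj₁ c#x , g≼c
  below-apartOrInside-∩ x {g} ((b , inj₂ b̂⊆U , g≼b) , (c , inj₂ ĉ⊆W , g≼c)) =
    g , inj₂ (λ {z} z∈ → b̂⊆U (hat-mono g≼b {z} z∈) , ĉ⊆W (hat-mono g≼c {z} z∈)) , ≼-refl

  inductivelyOpen-∅ : InductivelyOpen (λ _ → ⊥)
  inductivelyOpen-∅ = (λ _ ()) , (λ _ ())

  inductivelyOpen-full : InductivelyOpen (λ _ → Unit)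
  inductivelyOpen-full = (λ _ _ _ → inj₂ (0 , _)) , (λ _ _ → inductiveBar-⊤ (inj₂ _))

  inductivelyOpen-∩ : ∀ U W → InductivelyOpen U → InductivelyOpen W → InductivelyOpen (U ∩ W)
  inductivelyOpen-∩ U W (U-apartOpen , U-bar) (W-apartOpen , W-bar) =
    apartOpen-∩ U-apartOpen W-apartOpen ,
    λ x (Ux , Wx) → inductiveBar-below
      (inductiveBar-mono (below-apartOrInside-∩ x) (inductiveBar-∩ (U-bar x Ux) (W-bar x Wx)))

  inductivelyOpen-⋃ : ∀ (I : Set) (U : I → Pred Point 0ℓ) → (∀ i → InductivelyOpen (U i)) →
    InductivelyOpen (λ x → ∃[ i ] U i x)
  inductivelyOpen-⋃ I U U-open =
    apartOpen-⋃ I U (λ i → proj₁ (U-open i)) ,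
    λ x (i , Uᵢx) → inductiveBar-mono (apartOrInside-mono x (i ,_)) (proj₂ (U-open i) x Uᵢx)

  inductivelyOpen-isTopology : IsTopology InductivelyOpen
  inductivelyOpen-isTopology = record
    { empty-open = inductivelyOpen-∅
    ; full-open  = inductivelyOpen-full
    ; inter-open = inductivelyOpen-∩
    ; union-open = inductivelyOpen-⋃
    }

module InductiveSpraidProperties (S : Spraid) (S-inductive : Spraid.IsInductive S) where
  open Spraid S
  open PreNaturalSpace pns
  open PreNaturalSpaceProperties pns
  open IsInductive S-inductive

  inductiveBar-apartFromAll-⊎ : ∀ A B → (∀ a b → a ∈ A → b ∈ B → a # b) →
    InductiveBar (λ c → (∀ a → a ∈ A → c # a) ⊎ (∀ b → b ∈ B → c # b))
  inductiveBar-apartFromAll-⊎ A B A#B =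
    inductiveBar-mono
      (λ {c} c#pairs → ∀∈×∀∈-⊎ (#-dec c) A B λ a b a∈A b∈B → c#pairs (a , b) (∈-cartesianProduct⁺ a∈A b∈B))
      (inductiveBar-⋂ (uncurry λ a b → downClosed-∪ (#-downClosed a) (#-downClosed b))
        (cartesianProduct A B)
        (uncurry λ a b ab∈A×B → let (a∈A , b∈B) = ∈-cartesianProduct⁻ A B ab∈A×B in
                                ind-apart a b (A#B a b a∈A b∈B)))

open SpraidProperties using (inductivelyOpen-isTopology)
open InductiveSpraidProperties using (inductiveBar-apartFromAll-⊎)

mainTheorem18 :
    (∀ (S : Spraid) →
      IsTopology (Spraid.InductivelyOpen S)
      × (∀ (U : Pred (PreNaturalSpace.Point (Spraid.pns S)) 0ℓ) →
           Spraid.InductivelyOpen S U → PreNaturalSpace.ApartOpen (Spraid.pns S) U))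
    ×
    (∀ (S : Spraid) → Spraid.IsInductive S →
      ∀ (A B : List (PreNaturalSpace.V (Spraid.pns S))) →
      (∀ a b → a ∈ A → b ∈ B → PreNaturalSpace._#_ (Spraid.pns S) a b) →
      PreNaturalSpace.InductiveBar (Spraid.pns S)
        (λ c → (∀ a → a ∈ A → PreNaturalSpace._#_ (Spraid.pns S) c a)
             ⊎ (∀ b → b ∈ B → PreNaturalSpace._#_ (Spraid.pns S) c b)))
mainTheorem18 =
  (λ S → inductivelyOpen-isTopology S , λ _ → proj₁) , inductiveBar-apartFromAll-⊎
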